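{- Let $F=\langle W,R,\{S_x\}_{x\in W}\rangle$ be any $\mathbf{IL}^-$-frame. Then the following are equivalent: (1) $\mathbf{J2}_+$ is valid in $F$; (2) $\mathbf{J2}$ is valid in $F$; (3) $\mathbf{J4}$ is valid in $F$ and for every $x\in W$, $S_x$ is transitive.
   Context: Formulas are built from propositional variables, $\top,\bot$, $\neg,\land,\lor,\to$, unary $\Box$ and binary $\rhd$; $\Diamond A$ abbreviates $\neg\Box\neg A$. Schemata: $\mathbf{J2}$: $(A\rhd B)\land(B\rhd C)\to A\rhd C$; $\mathbf{J2}_+$: $(A\rhd(B\lor C))\land(B\rhd C)\to A\rhd C$; $\mathbf{J4}$: $A\rhd B\to(\Diamond A\to\Diamond B)$. An $\mathbf{IL}^-$-frame is a triple $\langle W,R,\{S_x\}_{x\in W}\rangle$ with $W$ nonempty, $R$ transitive and conversely well-founded on $W$, each $S_x$ a binary relation on $W$ with $yS_xz\Rightarrow xRy$. Satisfaction: usual Boolean clauses, $x\Vdash\Box A$ iff $y\Vdash A$ for all $y$ with $xRy$, $x\Vdash A\rhd B$ iff for every $y$ with $xRy$, $y\Vdash A$ there is $z$ with $yS_xz$, $z\Vdash B$. A schema is valid in a frame if every instance holds at every point under every satisfaction relation. -}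

module Defs where

open import Data.Nat using (ℕ)
open import Data.Product using (Σ; _×_; _,_)
open import Data.Sum using (_⊎_)
open import Data.Unit using (⊤)
open import Data.Empty using (⊥)
open import Relation.Nullary using (¬_)
open import Relation.Binary.Core using (Rel)
open import Relation.Binary.Definitions using (Transitive)
open import Induction.WellFounded using (WellFounded)
open import Function using (flip)
open import Level using (0ℓ)

data Fm : Set where
  var  : ℕ → Fm
  ⊤'   : Fm
  ⊥'   : Fm
  ¬'_  : Fm → Fm
  _∧'_ : Fm → Fm → Fm
  _∨'_ : Fm → Fm → Fm
  _⇒'_ : Fm → Fm → Fm
  □_   : Fm → Fm
  _▷_  : Fm → Fm → Fm

infixr 6 _∧'_
infixr 5 _∨'_
infixr 4 _⇒'_
infix 7 ¬'_ □_ ◇_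
infix 8 _▷_

◇_ : Fm → Fm
◇ A = ¬' □ (¬' A)

record ILFrame : Set₁ where
  field
    W       : Set
    inhabited : W
    R       : Rel W 0ℓ
    R-trans : Transitive R
    R-cwf   : WellFounded (flip R)
    S       : W → Rel W 0ℓ
    S⊆R     : ∀ {x y z} → S x y z → R x y

module _ (F : ILFrame) where
  open ILFrame F

  Valuation : Set₁
  Valuation = ℕ → W → Set

  Sat : Valuation → W → Fm → Set
  Sat V x (var p)  = V p x
  Sat V x ⊤'       = ⊤
  Sat V x ⊥'       = ⊥
  Sat V x (¬' A)   = ¬ Sat V x A
  Sat V x (A ∧' B) = Sat V x A × Sat V x B
  Sat V x (A ∨' B) = Sat V x A ⊎ Sat V x B
  Sat V x (A ⇒' B) = Sat V x A → Sat V x B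
  Sat V x (□ A)    = ∀ y → R x y → Sat V y A
  Sat V x (A ▷ B)  = ∀ y → R x y → Sat V y A → Σ W λ z → S x y z × Sat V z B

  ValidFm : Fm → Set₁
  ValidFm A = ∀ (V : Valuation) (x : W) → Sat V x A

J2 : Fm → Fm → Fm → Fm
J2 A B C = (A ▷ B) ∧' (B ▷ C) ⇒' A ▷ C

J2+ : Fm → Fm → Fm → Fm
J2+ A B C = (A ▷ (B ∨' C)) ∧' (B ▷ C) ⇒' A ▷ C

J4 : Fm → Fm → Fm
J4 A B = A ▷ B ⇒' (◇ A ⇒' ◇ B)

J2-valid : ILFrame → Set₁
J2-valid F = ∀ A B C → ValidFm F (J2 A B C)

J2+-valid : ILFrame → Set₁
J2+-valid F = ∀ A B C → ValidFm F (J2+ A B C)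

J4-valid : ILFrame → Set₁
J4-valid F = ∀ A B → ValidFm F (J4 A B)

S-transitive : ILFrame → Set
S-transitive F = ∀ x → Transitive (ILFrame.S F x)

-- Both sides are pinned to two first-order frame conditions:
--   (a) S_x ⊆ R[x], i.e. y S_x z ⇒ x R z   (the correspondent of J4), and
--   (b) every S_x is transitive.
-- Soundness: (a) and (b) validate J2₊ (the witness for B is pushed along S_x,
-- using (a) to see it is an R-successor of x), and (a) validates J4.
-- Syntactic links: J2₊ implies J2 (weaken B to B ∨ C), and J2 implies J4
-- instance-wise (take C := ⊥, so that B ▷ ⊥ says □¬B).
-- Correspondence: with a valuation making variables true at single points,
-- J2 forces (b), and J4 forces (a); the latter is the only step that needs
-- excluded middle, to decide whether x R z holds.
module Submission where

open import Defs
open import Data.Product using (_×_; _,_)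
open import Data.Sum using (inj₁; inj₂)
open import Data.Empty using (⊥-elim)
open import Function.Bundles using (_⇔_; mk⇔)
open import Axiom.ExcludedMiddle using (ExcludedMiddle)
open import Level using (0ℓ)
open import Relation.Nullary.Decidable using (decidable-stable)
open import Relation.Binary.PropositionalEquality using (_≡_; refl; subst)

module _ (F : ILFrame) where
  open ILFrame F

  -- The frame condition corresponding to J4: S_x only relates R-successors of x.
  S-within-R : Set
  S-within-R = ∀ {x y z} → S x y z → R x z

  p q r : Fm
  p = var 0
  q = var 1
  r = var 2

  pinned : W → W → W → Valuation F
  pinned u v w 0 = _≡ u
  pinned u v w 1 = _≡ v
  pinned u v w _ = _≡ w

  edge⇒▷ : ∀ (V : Valuation F) i j {x a b} →
           (∀ {y} → V i y → y ≡ a) → V j b → S x a b → Sat F V x (var i ▷ var j)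
  edge⇒▷ V i j only-a j-at-b s y _ i-at-y with only-a i-at-y
  ... | refl = _ , s , j-at-b

  conditions⇒J2+ : S-within-R → S-transitive F → J2+-valid F
  conditions⇒J2+ within trans A B C V x (A▷B∨C , B▷C) y Rxy Ay with A▷B∨C y Rxy Ay
  ... | z , Sxyz , inj₂ Cz = z , Sxyz , Cz
  ... | z , Sxyz , inj₁ Bz with B▷C z (within Sxyz) Bz
  ...   | w , Sxzw , Cw = w , trans x Sxyz Sxzw , Cw

  S-within-R⇒J4 : S-within-R → J4-valid F
  S-within-R⇒J4 within A B V x A▷B ◇A □¬B = ◇A λ y Rxy Ay →
    let (z , Sxyz , Bz) = A▷B y Rxy Ay in □¬B z (within Sxyz) Bz

  J2+⇒J2 : J2+-valid F → J2-valid F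
  J2+⇒J2 j2+ A B C V x (A▷B , B▷C) = j2+ A B C V x (weaken , B▷C)
    where
    weaken : Sat F V x (A ▷ (B ∨' C))
    weaken y Rxy Ay = let (z , Sxyz , Bz) = A▷B y Rxy Ay in z , Sxyz , inj₁ Bz

  -- J2 implies J4: the instance J2(A, B, ⊥) reads (A ▷ B) ∧ □¬B → □¬A.
  J2⇒J4 : J2-valid F → J4-valid F
  J2⇒J4 j2 A B V x A▷B ◇A □¬B = ◇A λ y Rxy Ay →
    let (_ , _ , falsum) = j2 A B ⊥' V x (A▷B , B▷⊥) y Rxy Ay in falsum
    where
    B▷⊥ : Sat F V x (B ▷ ⊥')
    B▷⊥ y Rxy By = ⊥-elim (□¬B y Rxy By)

  -- J2 forces transitivity of S_x: for edges u S_x v S_x w, the instance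
  -- J2(p, q, r) under the valuation pinning p, q, r to u, v, w yields u S_x w.
  J2⇒S-transitive : J2-valid F → S-transitive F
  J2⇒S-transitive j2 x {u} {v} {w} Sxuv Sxvw
    with j2 p q r V x (edge⇒▷ V 0 1 (λ e → e) refl Sxuv , edge⇒▷ V 1 2 (λ e → e) refl Sxvw)
            u (S⊆R Sxuv) refl
    where
    V = pinned u v w
  ... | _ , Sxuw , refl = Sxuw

  -- J4 forces S-within-R: given y S_x z with ¬ x R z, pin p to y and q to z;
  -- then p ▷ q and ◇p hold at x but ◇q fails, contradicting J4(p, q).
  J4⇒S-within-R : ExcludedMiddle 0ℓ → J4-valid F → S-within-R
  J4⇒S-within-R em j4 {x} {y} {z} Sxyz = decidable-stable em λ ¬Rxz →
    j4 p q V x (edge⇒▷ V 0 1 (λ e → e) refl Sxyz)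
       (λ □¬p → □¬p y (S⊆R Sxyz) refl)
       (λ w Rxw w≡z → ¬Rxz (subst (R x) w≡z Rxw))
    where
    V = pinned y z z

proposition3p15 : ExcludedMiddle 0ℓ → (F : ILFrame) →
    ((J2+-valid F ⇔ J2-valid F) × (J2-valid F ⇔ (J4-valid F × S-transitive F)))
proposition3p15 em F =
  mk⇔ (J2+⇒J2 F) (λ j2 → J4×trans⇒J2+ (J2⇒J4 F j2 , J2⇒S-transitive F j2)) ,
  mk⇔ (λ j2 → J2⇒J4 F j2 , J2⇒S-transitive F j2) (λ c → J2+⇒J2 F (J4×trans⇒J2+ c))
  where
  J4×trans⇒J2+ : J4-valid F × S-transitive F → J2+-valid F
  J4×trans⇒J2+ (j4 , trans) = conditions⇒J2+ F (J4⇒S-within-R F em j4) trans
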